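{- Let $2\le k\le n-2$ and $r=n-k$. Then $$F_{k,n}(x):=\sum_{F\in\Delta_k(P_n^2)}x^{|F|}=\sum_{p=0}^{r}\binom{n}{p}x^p-rx^{r-1}-z_{k,n}x^r,$$ where $z_{k,n}=\sum_{j=0}^{\min\{k-1,r\}}\binom{k-1}{j}(r-j+1)$. Equivalently, the number of faces of $\Delta_k(P_n^2)$ of cardinality $p$ is $\binom{n}{p}$ for $0\le p\le r-2$, is $\binom{n}{r-1}-r$ for $p=r-1$, and is $\binom{n}{r}-z_{k,n}$ for $p=r$ (and there are no faces of cardinality greater than $r$).
   Context: For a finite simple graph $G$ on $[n]=\{1,\dots,n\}$ and $2\le k\le n$, the $k$-cut complex $\Delta_k(G)$ is the simplicial complex on $[n]$ whose facets are the sets $[n]\setminus T$, where $T$ ranges over the $k$-element subsets of $[n]$ with $G[T]$ disconnected. The squared path $P_n^2$ is the graph on $[n]$ whose edges are the pairs $\{i,i+1\}$ ($1\le i\le n-1$) and $\{i,i+2\}$ ($1\le i\le n-2$). The sum over faces includes the empty face. -}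

module Defs where

open import Data.Nat using (ℕ; zero; suc; _+_; _*_; _∸_; _≤_; _<_; ∣_-_∣; _⊓_)
open import Data.Nat.Combinatorics using (_C_)
open import Data.Integer as ℤ using (ℤ; +_)
open import Data.Fin using (Fin; toℕ)
open import Data.Fin.Subset using (Subset; _∈_; _⊆_; ∁; ∣_∣)
open import Data.List using (List; length)
import Data.List.Membership.Propositional as L
open import Data.List.Relation.Unary.Unique.Propositional using (Unique)
open import Data.Product using (Σ; _×_; ∃)
open import Relation.Nullary using (¬_)
open import Relation.Binary.PropositionalEquality using (_≡_)
open import Function.Bundles using (_⇔_)

-- Vertices of [n] are represented by Fin n (vertex i+1 of the paper is i).
-- Adjacency of the squared path P_n^2: i ~ j iff 1 ≤ |i - j| ≤ 2.
P²-Adj : ∀ {n} → Fin n → Fin n → Set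
P²-Adj i j = (1 ≤ ∣ toℕ i - toℕ j ∣) × (∣ toℕ i - toℕ j ∣ ≤ 2)

data Walk {n : ℕ} (Adj : Fin n → Fin n → Set) (T : Subset n) : Fin n → Fin n → Set where
  here : ∀ {u} → u ∈ T → Walk Adj T u u
  step : ∀ {u w v} → u ∈ T → Adj u w → Walk Adj T w v → Walk Adj T u v

Connected : ∀ {n} → (Fin n → Fin n → Set) → Subset n → Set
Connected {n} Adj T =
  (Σ (Fin n) λ u → u ∈ T) × (∀ u v → u ∈ T → v ∈ T → Walk Adj T u v)

Disconnected : ∀ {n} → (Fin n → Fin n → Set) → Subset n → Set
Disconnected Adj T = ¬ Connected Adj T

-- Faces of the k-cut complex Δ_k(G): subsets of some facet [n] \ T,
-- with |T| = k and G[T] disconnected.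
IsCutFace : ∀ {n} → (Fin n → Fin n → Set) → ℕ → Subset n → Set
IsCutFace {n} Adj k F =
  Σ (Subset n) λ T → (∣ T ∣ ≡ k) × Disconnected Adj T × (F ⊆ ∁ T)

-- "The number of faces of Δ_k(G) of cardinality p is m":
-- there is a duplicate-free list of exactly those faces, of length m.
NumFaces : ∀ {n} → (Fin n → Fin n → Set) → ℕ → ℕ → ℕ → Set
NumFaces {n} Adj k p m =
  Σ (List (Subset n)) λ Fs →
    Unique Fs × (∀ F → (F L.∈ Fs) ⇔ (IsCutFace Adj k F × ∣ F ∣ ≡ p)) × (length Fs ≡ m)

sumTo : ℕ → (ℕ → ℕ) → ℕ
sumTo zero f = f 0
sumTo (suc m) f = sumTo m f + f (suc m)

z : ℕ → ℕ → ℕ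
z k n = sumTo ((k ∸ 1) ⊓ r) (λ j → ((k ∸ 1) C j) * (r ∸ j + 1))
  where r = n ∸ k

[_≤?_] : ℕ → ℕ → ℕ
[ zero ≤? _ ] = 1
[ suc a ≤? zero ] = 0
[ suc a ≤? suc b ] = [ a ≤? b ]

[_≡?_] : ℕ → ℕ → ℕ
[ a ≡? b ] = [ a ≤? b ] * [ b ≤? a ]

-- Coefficient of x^p in  Σ_{q=0}^{r} C(n,q) x^q - r x^{r-1} - z_{k,n} x^r,  r = n - k
coeffF : ℕ → ℕ → ℕ → ℤ
coeffF k n p =
  ((+ ([ p ≤? r ] * (n C p))) ℤ.- (+ ([ p ≡? (r ∸ 1) ] * r))) ℤ.- (+ ([ p ≡? r ] * z k n))
  where r = n ∸ k

-- F is a face of Δ_k(P²_n) iff its complement S contains a k-set T inducing a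
-- disconnected subgraph, and T induces a connected subgraph of P²_n iff it is nonempty and has
-- no two consecutive non-members between its least and greatest elements. So the faces of size
-- p = n − |S| are counted by classifying S. If |S| < k there are none. If |S| = k, S itself must
-- be disconnected, and the connected k-sets are counted by a recursion on the first position,
-- which produces z_{k,n}. If |S| = k + 1, S qualifies unless it is an interval: removing one
-- element of an interval leaves it connected, while some element of a non-interval can be removed
-- to create a double gap; there are r intervals of size k + 1. If |S| ≥ k + 2, S always
-- contains a disconnected k-set: keep its first member, skip the next two positions, and take
-- any k − 1 further members.

module Submission where

open import Defs
open import Data.Nat using (ℕ; zero; suc; _+_; _*_; _∸_; _≤_; _<_; z≤n; s≤s; ∣_-_∣)
open import Data.Nat.Properties hiding (_≤?_)
open import Data.Nat.Tactic.RingSolver using (solve-∀)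
open import Data.Nat.Combinatorics using (_C_; nCk+nC[k+1]≡[n+1]C[k+1]; k>n⇒nCk≡0; nCk≡nC[n∸k])
open import Data.Bool using (Bool; true; false; not; T; T?)
open import Data.Bool.Properties using (T-not-≡; not-involutive)
open import Data.Vec using ([]; _∷_; here; there)
open import Data.Vec.Properties using (∷-injectiveʳ; map-∘; map-cong; map-id)
open import Data.List using (List; []; _∷_; _++_; map; length; filterᵇ)
open import Data.List.Properties using (length-map; length-++; filter-++; filter-none; filter-all)
open import Data.List.Membership.Propositional using () renaming (_∈_ to _∈ₗ_)
open import Data.List.Membership.Propositional.Properties
  using (∈-map⁺; ∈-map⁻; ∈-++⁺ˡ; ∈-++⁺ʳ; ∈-++⁻; ∈-filter⁺; ∈-filter⁻)
open import Data.List.Relation.Unary.Any using (here; there)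
import Data.List.Relation.Unary.All as All
open import Data.List.Relation.Unary.AllPairs using ([]; _∷_)
open import Data.List.Relation.Unary.Unique.Propositional using (Unique)
import Data.List.Relation.Unary.Unique.Propositional.Properties as Unique
open import Data.Fin using (Fin; zero; suc; toℕ)
open import Data.Fin.Properties using (toℕ-injective)
open import Data.Fin.Subset using (Subset; inside; outside; ⊥; _∈_; _⊆_; ∁; ∣_∣; Nonempty; Empty)
open import Data.Fin.Subset.Properties
  using (∣p∣≤n; ⊆-refl; drop-∷-⊆; in⊆in; out⊆; ⊥⊆; ∣⊥∣≡0; p⊆q⇒∣p∣≤∣q∣; ∣∁p∣≡n∸∣p∣; x∉p⇒x∈∁p; x∈∁p⇒x∉p)
open import Data.Integer as ℤ using (+_)
import Data.Integer.Properties as ℤP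
open import Data.Unit using (⊤)
open import Data.Product using (Σ; _×_; _,_)
open import Data.Sum using (_⊎_; inj₁; inj₂)
open import Function using (_∘_)
open import Function.Bundles using (_⇔_; mk⇔; Equivalence)
open import Relation.Nullary using (¬_; contradiction)
open import Relation.Binary.Definitions using (tri<; tri≈; tri>)
open import Relation.Binary.PropositionalEquality
  using (_≡_; refl; sym; trans; cong; cong₂; subst; module ≡-Reasoning)

-- Subsets of a given size, and counting them

subsets : ∀ n → ℕ → List (Subset n)
subsets zero    zero    = [] ∷ []
subsets zero    (suc q) = []
subsets (suc n) zero    = map (outside ∷_) (subsets n zero)
subsets (suc n) (suc q) = map (inside ∷_) (subsets n q) ++ map (outside ∷_) (subsets n (suc q))

length-subsets : ∀ n q → length (subsets n q) ≡ n C q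
length-subsets zero    zero    = refl
length-subsets zero    (suc q) = refl
length-subsets (suc n) zero    = trans (length-map _ (subsets n zero)) (length-subsets n zero)
length-subsets (suc n) (suc q) = begin
  length (map (inside ∷_) (subsets n q) ++ map (outside ∷_) (subsets n (suc q)))
    ≡⟨ length-++ (map (inside ∷_) (subsets n q)) ⟩
  length (map (inside ∷_) (subsets n q)) + length (map (outside ∷_) (subsets n (suc q)))
    ≡⟨ cong₂ _+_ (length-map _ (subsets n q)) (length-map _ (subsets n (suc q))) ⟩
  length (subsets n q) + length (subsets n (suc q))
    ≡⟨ cong₂ _+_ (length-subsets n q) (length-subsets n (suc q)) ⟩
  n C q + n C suc q
    ≡⟨ nCk+nC[k+1]≡[n+1]C[k+1] n q ⟩
  suc n C suc q ∎
  where open ≡-Reasoning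

subsets-zero : ∀ n → subsets n zero ≡ ⊥ ∷ []
subsets-zero zero    = refl
subsets-zero (suc n) = cong (map (outside ∷_)) (subsets-zero n)

∈-subsets⁻ : ∀ {n q} {S : Subset n} → S ∈ₗ subsets n q → ∣ S ∣ ≡ q
∈-subsets⁻ {zero}  {zero}  (here refl) = refl
∈-subsets⁻ {suc n} {zero}  S∈ with ∈-map⁻ (outside ∷_) S∈
... | _ , S∈′ , refl = ∈-subsets⁻ S∈′
∈-subsets⁻ {suc n} {suc q} S∈ with ∈-++⁻ (map (inside ∷_) (subsets n q)) S∈
... | inj₁ S∈ᵢ with ∈-map⁻ (inside ∷_) S∈ᵢ
...   | _ , S∈′ , refl = cong suc (∈-subsets⁻ S∈′)
∈-subsets⁻ {suc n} {suc q} S∈ | inj₂ S∈ₒ with ∈-map⁻ (outside ∷_) S∈ₒ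
...   | _ , S∈′ , refl = ∈-subsets⁻ S∈′

∈-subsets⁺ : ∀ {n q} (S : Subset n) → ∣ S ∣ ≡ q → S ∈ₗ subsets n q
∈-subsets⁺ {zero}  {zero}  []            _ = here refl
∈-subsets⁺ {suc n} {zero}  (outside ∷ S) e = ∈-map⁺ (outside ∷_) (∈-subsets⁺ S e)
∈-subsets⁺ {suc n} {suc q} (inside ∷ S)  e = ∈-++⁺ˡ (∈-map⁺ (inside ∷_) (∈-subsets⁺ S (suc-injective e)))
∈-subsets⁺ {suc n} {suc q} (outside ∷ S) e = ∈-++⁺ʳ _ (∈-map⁺ (outside ∷_) (∈-subsets⁺ S e))

subsets-unique : ∀ n q → Unique (subsets n q)
subsets-unique zero    zero    = All.[] ∷ []
subsets-unique zero    (suc q) = []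
subsets-unique (suc n) zero    = Unique.map⁺ ∷-injectiveʳ (subsets-unique n zero)
subsets-unique (suc n) (suc q) =
  Unique.++⁺ (Unique.map⁺ ∷-injectiveʳ (subsets-unique n q))
             (Unique.map⁺ ∷-injectiveʳ (subsets-unique n (suc q)))
             heads-differ
  where
  heads-differ : ∀ {S} → ¬ (S ∈ₗ map (inside ∷_) (subsets n q) × S ∈ₗ map (outside ∷_) (subsets n (suc q)))
  heads-differ (S∈ᵢ , S∈ₒ) with ∈-map⁻ (inside ∷_) S∈ᵢ | ∈-map⁻ (outside ∷_) S∈ₒ
  ... | _ , _ , refl | _ , _ , ()

filterᵇ-map : ∀ {A B : Set} (P : B → Bool) (f : A → B) xs →
              filterᵇ P (map f xs) ≡ map f (filterᵇ (P ∘ f) xs)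
filterᵇ-map P f []       = refl
filterᵇ-map P f (x ∷ xs) with P (f x)
... | true  = cong (f x ∷_) (filterᵇ-map P f xs)
... | false = filterᵇ-map P f xs

length-filterᵇ-not : ∀ {A : Set} (P : A → Bool) xs →
                     length (filterᵇ (not ∘ P) xs) + length (filterᵇ P xs) ≡ length xs
length-filterᵇ-not P []       = refl
length-filterᵇ-not P (x ∷ xs) with P x
... | true  = trans (+-suc _ _) (cong suc (length-filterᵇ-not P xs))
... | false = cong suc (length-filterᵇ-not P xs)

count : ∀ n → (Subset n → Bool) → ℕ → ℕ
count n P q = length (filterᵇ P (subsets n q))

count-∷ : ∀ n (P : Subset (suc n) → Bool) q →
          count (suc n) P (suc q) ≡ count n (P ∘ (inside ∷_)) q + count n (P ∘ (outside ∷_)) (suc q)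
count-∷ n P q = begin
  length (filterᵇ P (map (inside ∷_) Sᵢ ++ map (outside ∷_) Sₒ))
    ≡⟨ cong length (filter-++ (T? ∘ P) (map (inside ∷_) Sᵢ) _) ⟩
  length (filterᵇ P (map (inside ∷_) Sᵢ) ++ filterᵇ P (map (outside ∷_) Sₒ))
    ≡⟨ length-++ (filterᵇ P (map (inside ∷_) Sᵢ)) ⟩
  length (filterᵇ P (map (inside ∷_) Sᵢ)) + length (filterᵇ P (map (outside ∷_) Sₒ))
    ≡⟨ cong₂ (λ xs ys → length xs + length ys) (filterᵇ-map P _ Sᵢ) (filterᵇ-map P _ Sₒ) ⟩
  length (map (inside ∷_) (filterᵇ (P ∘ (inside ∷_)) Sᵢ)) +
  length (map (outside ∷_) (filterᵇ (P ∘ (outside ∷_)) Sₒ))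
    ≡⟨ cong₂ _+_ (length-map _ (filterᵇ _ Sᵢ)) (length-map _ (filterᵇ _ Sₒ)) ⟩
  count n (P ∘ (inside ∷_)) q + count n (P ∘ (outside ∷_)) (suc q) ∎
  where
  open ≡-Reasoning
  Sᵢ = subsets n q
  Sₒ = subsets n (suc q)

count-zero : ∀ n (P : Subset n → Bool) → P ⊥ ≡ true → count n P 0 ≡ 1
count-zero n P P⊥ rewrite subsets-zero n | P⊥ = refl

count-none : ∀ n (P : Subset n → Bool) q → (∀ S → ∣ S ∣ ≡ q → P S ≡ false) → count n P q ≡ 0
count-none n P q none =
  cong length (filter-none (T? ∘ P) (All.tabulate λ {S} S∈ → subst T (none S (∈-subsets⁻ S∈))))

count-all : ∀ n (P : Subset n → Bool) q → (∀ S → ∣ S ∣ ≡ q → P S ≡ true) → count n P q ≡ n C q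
count-all n P q all =
  trans (cong length (filter-all (T? ∘ P) (All.tabulate λ {S} S∈ → subst T (sym (all S (∈-subsets⁻ S∈))) _)))
        (length-subsets n q)

count-not : ∀ n (P : Subset n → Bool) q → count n (not ∘ P) q + count n P q ≡ n C q
count-not n P q = trans (length-filterᵇ-not P (subsets n q)) (length-subsets n q)

count-oversized : ∀ n (P : Subset n → Bool) q → n < q → count n P q ≡ 0
count-oversized n P q n<q = count-none n P q λ S ∣S∣≡q →
  contradiction (subst (_≤ n) ∣S∣≡q (∣p∣≤n S)) (<⇒≱ n<q)

n+0<1+n : ∀ n → n + 0 < suc n
n+0<1+n n = s≤s (≤-reflexive (+-identityʳ n))

-- Partial sums of binomial coefficients

sumTo-cong : ∀ m {f g : ℕ → ℕ} → (∀ j → j ≤ m → f j ≡ g j) → sumTo m f ≡ sumTo m g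
sumTo-cong zero    f≗g = f≗g 0 z≤n
sumTo-cong (suc m) f≗g = cong₂ _+_ (sumTo-cong m λ j j≤m → f≗g j (m≤n⇒m≤1+n j≤m)) (f≗g (suc m) ≤-refl)

sumTo-distrib-+ : ∀ m (f g : ℕ → ℕ) → sumTo m (λ j → f j + g j) ≡ sumTo m f + sumTo m g
sumTo-distrib-+ zero    f g = refl
sumTo-distrib-+ (suc m) f g rewrite sumTo-distrib-+ m f g =
  +-exchange (sumTo m f) (sumTo m g) (f (suc m)) (g (suc m))
  where
  +-exchange : ∀ a b c d → a + b + (c + d) ≡ a + c + (b + d)
  +-exchange = solve-∀

sumTo-vanishing : ∀ {a b} (f : ℕ → ℕ) → a ≤ b → (∀ j → a < j → f j ≡ 0) → sumTo a f ≡ sumTo b f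
sumTo-vanishing {b = zero}  f z≤n _ = refl
sumTo-vanishing {a} {suc b} f a≤1+b f≡0 with m≤n⇒m<n∨m≡n a≤1+b
... | inj₂ refl      = refl
... | inj₁ (s≤s a≤b) = begin
  sumTo a f              ≡⟨ sumTo-vanishing f a≤b f≡0 ⟩
  sumTo b f              ≡⟨ +-identityʳ _ ⟨
  sumTo b f + 0          ≡⟨ cong (λ x → sumTo b f + x) (f≡0 (suc b) (s≤s a≤b)) ⟨
  sumTo b f + f (suc b)  ∎
  where open ≡-Reasoning

rowSum : ℕ → ℕ → ℕ
rowSum s d = sumTo d (s C_)

rowSum-zeroˡ : ∀ d → rowSum 0 d ≡ 1
rowSum-zeroˡ zero    = refl
rowSum-zeroˡ (suc d) = trans (+-identityʳ _) (rowSum-zeroˡ d)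

rowSum-pascal : ∀ s d → rowSum (suc s) (suc d) ≡ rowSum s (suc d) + rowSum s d
rowSum-pascal s zero
  rewrite sym (nCk+nC[k+1]≡[n+1]C[k+1] s 0) = +-comm 1 (1 + s C 1)
rowSum-pascal s (suc d) = begin
  rowSum (suc s) (suc d) + suc s C suc (suc d)
    ≡⟨ cong₂ _+_ (rowSum-pascal s d) (sym (nCk+nC[k+1]≡[n+1]C[k+1] s (suc d))) ⟩
  rowSum s (suc d) + rowSum s d + (s C suc d + s C suc (suc d))
    ≡⟨ regroup (rowSum s (suc d)) (rowSum s d) (s C suc d) (s C suc (suc d)) ⟩
  rowSum s (suc (suc d)) + rowSum s (suc d) ∎
  where
  open ≡-Reasoning
  regroup : ∀ a b x y → a + b + (x + y) ≡ a + y + (b + x)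
  regroup = solve-∀

weightedRowSum : ℕ → ℕ → ℕ
weightedRowSum s r = sumTo r λ j → (s C j) * (r ∸ j + 1)

weightedRowSum-suc : ∀ s r → weightedRowSum s (suc r) ≡ rowSum s (suc r) + weightedRowSum s r
weightedRowSum-suc s r = begin
  sumTo r (λ j → (s C j) * (suc r ∸ j + 1)) + (s C suc r) * (suc r ∸ suc r + 1)
    ≡⟨ cong₂ _+_ (sumTo-cong r λ j j≤r → cong (λ t → (s C j) * (t + 1)) (+-∸-assoc 1 j≤r))
                 (cong (λ t → (s C suc r) * (t + 1)) (n∸n≡0 r)) ⟩
  sumTo r (λ j → (s C j) * (suc (r ∸ j) + 1)) + (s C suc r) * 1
    ≡⟨ cong₂ _+_ (sumTo-cong r λ j _ → split (s C j) (r ∸ j)) (*-identityʳ _) ⟩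
  sumTo r (λ j → (s C j) * (r ∸ j + 1) + s C j) + s C suc r
    ≡⟨ cong (_+ s C suc r) (sumTo-distrib-+ r _ (s C_)) ⟩
  weightedRowSum s r + rowSum s r + s C suc r
    ≡⟨ rotate (weightedRowSum s r) (rowSum s r) (s C suc r) ⟩
  rowSum s (suc r) + weightedRowSum s r ∎
  where
  open ≡-Reasoning
  split : ∀ c t → c * (suc t + 1) ≡ c * (t + 1) + c
  split = solve-∀
  rotate : ∀ a b c → a + b + c ≡ b + c + a
  rotate = solve-∀

z≡weightedRowSum : ∀ s r → z (suc s) (suc s + r) ≡ weightedRowSum s r
z≡weightedRowSum s r rewrite m+n∸m≡n (suc s) r with ≤-total s r
... | inj₁ s≤r rewrite m≤n⇒m⊓n≡m s≤r =
  sumTo-vanishing _ s≤r λ j s<j → cong (_* (r ∸ j + 1)) (k>n⇒nCk≡0 s<j)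
... | inj₂ r≤s rewrite m≥n⇒m⊓n≡n r≤s = refl

-- Shapes of subsets, read as 0/1 words

isEmpty : ∀ {n} → Subset n → Bool
isEmpty []            = true
isEmpty (inside ∷ S)  = false
isEmpty (outside ∷ S) = isEmpty S

-- The word has no factor 00 that is followed, somewhere later, by a 1.
noDoubleGap : ∀ {n} → Subset n → Bool
noDoubleGap []                      = true
noDoubleGap (inside ∷ S)            = noDoubleGap S
noDoubleGap (outside ∷ [])          = true
noDoubleGap (outside ∷ inside ∷ S)  = noDoubleGap S
noDoubleGap (outside ∷ outside ∷ S) = isEmpty S

isP²Connected : ∀ {n} → Subset n → Bool
isP²Connected []            = false
isP²Connected (outside ∷ S) = isP²Connected S
isP²Connected (inside ∷ S)  = noDoubleGap S

isInitialSegment : ∀ {n} → Subset n → Bool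
isInitialSegment []            = true
isInitialSegment (inside ∷ S)  = isInitialSegment S
isInitialSegment (outside ∷ S) = isEmpty S

isInterval : ∀ {n} → Subset n → Bool
isInterval []            = false
isInterval (outside ∷ S) = isInterval S
isInterval (inside ∷ S)  = isInitialSegment S

isEmpty-⊥ : ∀ n → isEmpty (⊥ {n}) ≡ true
isEmpty-⊥ zero    = refl
isEmpty-⊥ (suc n) = isEmpty-⊥ n

noDoubleGap-⊥ : ∀ n → noDoubleGap (⊥ {n}) ≡ true
noDoubleGap-⊥ zero          = refl
noDoubleGap-⊥ (suc zero)    = refl
noDoubleGap-⊥ (suc (suc n)) = isEmpty-⊥ n

isInitialSegment-⊥ : ∀ n → isInitialSegment (⊥ {n}) ≡ true
isInitialSegment-⊥ zero    = refl
isInitialSegment-⊥ (suc n) = isEmpty-⊥ n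

isEmpty⇒∣∣≡0 : ∀ {n} (S : Subset n) → isEmpty S ≡ true → ∣ S ∣ ≡ 0
isEmpty⇒∣∣≡0 []            _ = refl
isEmpty⇒∣∣≡0 (outside ∷ S) e = isEmpty⇒∣∣≡0 S e

∣∣≡0⇒isEmpty : ∀ {n} (S : Subset n) → ∣ S ∣ ≡ 0 → isEmpty S ≡ true
∣∣≡0⇒isEmpty []            _ = refl
∣∣≡0⇒isEmpty (outside ∷ S) e = ∣∣≡0⇒isEmpty S e

∣∣≢0⇒isEmpty≡false : ∀ {n} (S : Subset n) → 1 ≤ ∣ S ∣ → isEmpty S ≡ false
∣∣≢0⇒isEmpty≡false (inside ∷ S)  _ = refl
∣∣≢0⇒isEmpty≡false (outside ∷ S) h = ∣∣≢0⇒isEmpty≡false S h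

isEmpty≡false⇒1≤∣∣ : ∀ {n} (S : Subset n) → isEmpty S ≡ false → 1 ≤ ∣ S ∣
isEmpty≡false⇒1≤∣∣ (inside ∷ S)  _ = s≤s z≤n
isEmpty≡false⇒1≤∣∣ (outside ∷ S) e = isEmpty≡false⇒1≤∣∣ S e

isInitialSegment≡false⇒1≤∣∣ : ∀ {n} (S : Subset n) → isInitialSegment S ≡ false → 1 ≤ ∣ S ∣
isInitialSegment≡false⇒1≤∣∣ (inside ∷ S)  _ = s≤s z≤n
isInitialSegment≡false⇒1≤∣∣ (outside ∷ S) e = isEmpty≡false⇒1≤∣∣ S e

isInitialSegment⇒noDoubleGap : ∀ {n} (S : Subset n) → isInitialSegment S ≡ true → noDoubleGap S ≡ true
isInitialSegment⇒noDoubleGap []                      _ = refl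
isInitialSegment⇒noDoubleGap (inside ∷ S)            e = isInitialSegment⇒noDoubleGap S e
isInitialSegment⇒noDoubleGap (outside ∷ [])          _ = refl
isInitialSegment⇒noDoubleGap (outside ∷ outside ∷ S) e = e

isInitialSegment⇒noDoubleGap-outside : ∀ {n} (S : Subset n) → isInitialSegment S ≡ true →
                                       noDoubleGap (outside ∷ S) ≡ true
isInitialSegment⇒noDoubleGap-outside []            _ = refl
isInitialSegment⇒noDoubleGap-outside (inside ∷ S)  e = isInitialSegment⇒noDoubleGap S e
isInitialSegment⇒noDoubleGap-outside (outside ∷ S) e = e

isInitialSegment⇒isP²Connected : ∀ {n} (S : Subset n) → isInitialSegment S ≡ true → 1 ≤ ∣ S ∣ →
                                 isP²Connected S ≡ true
isInitialSegment⇒isP²Connected (inside ∷ S)  e _ = isInitialSegment⇒noDoubleGap S e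
isInitialSegment⇒isP²Connected (outside ∷ S) e h = contradiction (isEmpty⇒∣∣≡0 S e) (m<n⇒n≢0 h)

count-isEmpty : ∀ n q → count n isEmpty (suc q) ≡ 0
count-isEmpty n q = count-none n isEmpty (suc q) λ S ∣S∣≡1+q →
  ∣∣≢0⇒isEmpty≡false S (subst (1 ≤_) (sym ∣S∣≡1+q) (s≤s z≤n))

count-outside-noDoubleGap : ∀ n q → count (suc n) (noDoubleGap ∘ (outside ∷_)) (suc q) ≡ count n noDoubleGap q
count-outside-noDoubleGap n q = begin
  count (suc n) (noDoubleGap ∘ (outside ∷_)) (suc q)
    ≡⟨ count-∷ n (noDoubleGap ∘ (outside ∷_)) q ⟩
  count n noDoubleGap q + count n isEmpty (suc q)
    ≡⟨ cong (λ x → count n noDoubleGap q + x) (count-isEmpty n q) ⟩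
  count n noDoubleGap q + 0
    ≡⟨ +-identityʳ _ ⟩
  count n noDoubleGap q ∎
  where open ≡-Reasoning

count-noDoubleGap : ∀ s d → count (s + d) noDoubleGap s ≡ rowSum s d
count-noDoubleGap zero d = trans (count-zero d noDoubleGap (noDoubleGap-⊥ d)) (sym (rowSum-zeroˡ d))
count-noDoubleGap (suc s) zero = begin
  count (suc s + 0) noDoubleGap (suc s)
    ≡⟨ count-∷ (s + 0) noDoubleGap s ⟩
  count (s + 0) noDoubleGap s + count (s + 0) (noDoubleGap ∘ (outside ∷_)) (suc s)
    ≡⟨ cong₂ _+_ (count-noDoubleGap s zero) (count-oversized _ _ (suc s) (n+0<1+n s)) ⟩
  rowSum s 0 + 0
    ≡⟨ +-identityʳ _ ⟩
  rowSum (suc s) 0 ∎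
  where open ≡-Reasoning
count-noDoubleGap (suc s) (suc d) = begin
  count (suc s + suc d) noDoubleGap (suc s)
    ≡⟨ count-∷ (s + suc d) noDoubleGap s ⟩
  count (s + suc d) noDoubleGap s + count (s + suc d) (noDoubleGap ∘ (outside ∷_)) (suc s)
    ≡⟨ cong (λ m → count (s + suc d) noDoubleGap s + count m (noDoubleGap ∘ (outside ∷_)) (suc s)) (+-suc s d) ⟩
  count (s + suc d) noDoubleGap s + count (suc (s + d)) (noDoubleGap ∘ (outside ∷_)) (suc s)
    ≡⟨ cong₂ _+_ (count-noDoubleGap s (suc d))
                 (trans (count-outside-noDoubleGap (s + d) s) (count-noDoubleGap s d)) ⟩
  rowSum s (suc d) + rowSum s d
    ≡⟨ rowSum-pascal s d ⟨
  rowSum (suc s) (suc d) ∎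
  where open ≡-Reasoning

count-isP²Connected : ∀ s r → count (suc s + r) isP²Connected (suc s) ≡ weightedRowSum s r
count-isP²Connected s zero = begin
  count (suc s + 0) isP²Connected (suc s)
    ≡⟨ count-∷ (s + 0) isP²Connected s ⟩
  count (s + 0) noDoubleGap s + count (s + 0) isP²Connected (suc s)
    ≡⟨ cong₂ _+_ (count-noDoubleGap s 0) (count-oversized (s + 0) _ (suc s) (n+0<1+n s)) ⟩
  (s C 0) + 0
    ≡⟨ +-identityʳ _ ⟩
  s C 0
    ≡⟨ *-identityʳ _ ⟨
  weightedRowSum s 0 ∎
  where open ≡-Reasoning
count-isP²Connected s (suc r) = begin
  count (suc s + suc r) isP²Connected (suc s)
    ≡⟨ count-∷ (s + suc r) isP²Connected s ⟩
  count (s + suc r) noDoubleGap s + count (s + suc r) isP²Connected (suc s)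
    ≡⟨ cong (λ m → count (s + suc r) noDoubleGap s + count m isP²Connected (suc s)) (+-suc s r) ⟩
  count (s + suc r) noDoubleGap s + count (suc s + r) isP²Connected (suc s)
    ≡⟨ cong₂ _+_ (count-noDoubleGap s (suc r)) (count-isP²Connected s r) ⟩
  rowSum s (suc r) + weightedRowSum s r
    ≡⟨ weightedRowSum-suc s r ⟨
  weightedRowSum s (suc r) ∎
  where open ≡-Reasoning

count-isP²Connected≡z : ∀ s r → count (suc s + r) isP²Connected (suc s) ≡ z (suc s) (suc s + r)
count-isP²Connected≡z s r = trans (count-isP²Connected s r) (sym (z≡weightedRowSum s r))

count-isInitialSegment : ∀ s d → count (s + d) isInitialSegment s ≡ 1
count-isInitialSegment zero    d = count-zero d isInitialSegment (isInitialSegment-⊥ d)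
count-isInitialSegment (suc s) d = begin
  count (suc s + d) isInitialSegment (suc s)
    ≡⟨ count-∷ (s + d) isInitialSegment s ⟩
  count (s + d) isInitialSegment s + count (s + d) isEmpty (suc s)
    ≡⟨ cong₂ _+_ (count-isInitialSegment s d) (count-isEmpty (s + d) s) ⟩
  1 ∎
  where open ≡-Reasoning

count-isInterval : ∀ s r → count (suc s + r) isInterval (suc s) ≡ suc r
count-isInterval s zero = begin
  count (suc s + 0) isInterval (suc s)
    ≡⟨ count-∷ (s + 0) isInterval s ⟩
  count (s + 0) isInitialSegment s + count (s + 0) isInterval (suc s)
    ≡⟨ cong₂ _+_ (count-isInitialSegment s 0) (count-oversized (s + 0) _ (suc s) (n+0<1+n s)) ⟩
  1 ∎
  where open ≡-Reasoning
count-isInterval s (suc r) = begin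
  count (suc s + suc r) isInterval (suc s)
    ≡⟨ count-∷ (s + suc r) isInterval s ⟩
  count (s + suc r) isInitialSegment s + count (s + suc r) isInterval (suc s)
    ≡⟨ cong (λ m → count (s + suc r) isInitialSegment s + count m isInterval (suc s)) (+-suc s r) ⟩
  count (s + suc r) isInitialSegment s + count (suc s + r) isInterval (suc s)
    ≡⟨ cong₂ _+_ (count-isInitialSegment s (suc r)) (count-isInterval s r) ⟩
  suc (suc r) ∎
  where open ≡-Reasoning

-- Connectivity in the squared path

walk-source : ∀ {n} {Adj : Fin n → Fin n → Set} {S u v} → Walk Adj S u v → u ∈ S
walk-source (here u∈)     = u∈
walk-source (step u∈ _ _) = u∈

walk-++ : ∀ {n} {Adj : Fin n → Fin n → Set} {S u w v} → Walk Adj S u w → Walk Adj S w v → Walk Adj S u v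
walk-++ (here _)        q = q
walk-++ (step u∈ adj p) q = step u∈ adj (walk-++ p q)

walk-reverse : ∀ {n} {Adj : Fin n → Fin n → Set} {S u v} → (∀ {x y} → Adj x y → Adj y x) →
               Walk Adj S u v → Walk Adj S v u
walk-reverse adj-sym (here u∈)       = here u∈
walk-reverse adj-sym (step u∈ adj p) =
  walk-++ (walk-reverse adj-sym p) (step (walk-source p) (adj-sym adj) (here u∈))

P²-Adj-sym : ∀ {n} {x y : Fin n} → P²-Adj x y → P²-Adj y x
P²-Adj-sym {x = x} {y} adj rewrite ∣-∣-comm (toℕ x) (toℕ y) = adj

P²-Adj-+ : ∀ {n} {x y : Fin n} d → toℕ y ≡ toℕ x + d → 1 ≤ d → d ≤ 2 → P²-Adj x y
P²-Adj-+ {x = x} d y≡x+d 1≤d d≤2 rewrite y≡x+d | ∣m-m+n∣≡n (toℕ x) d = 1≤d , d≤2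

-- Membership indexed by ℕ (false from n on), so that positions next to a member need no bounds.
member : ∀ {n} → Subset n → ℕ → Bool
member []      _       = false
member (b ∷ S) zero    = b
member (b ∷ S) (suc i) = member S i

∈⇒member : ∀ {n} {S : Subset n} {x : Fin n} → x ∈ S → member S (toℕ x) ≡ true
∈⇒member here      = refl
∈⇒member (there x∈) = ∈⇒member x∈

member⇒∈ : ∀ {n} (S : Subset n) i → member S i ≡ true → Σ (Fin n) λ x → toℕ x ≡ i × x ∈ S
member⇒∈ (inside ∷ S) zero    _ = zero , refl , here
member⇒∈ (b ∷ S)      (suc i) e with member⇒∈ S i e
... | x , x≡i , x∈ = suc x , cong suc x≡i , there x∈

isEmpty⇒member≡false : ∀ {n} (S : Subset n) i → isEmpty S ≡ true → member S i ≡ false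
isEmpty⇒member≡false []            _       _ = refl
isEmpty⇒member≡false (outside ∷ S) zero    _ = refl
isEmpty⇒member≡false (outside ∷ S) (suc i) e = isEmpty⇒member≡false S i e

isEmpty≡false⇒member : ∀ {n} (S : Subset n) → isEmpty S ≡ false → Σ ℕ λ i → member S i ≡ true
isEmpty≡false⇒member (inside ∷ S)  _ = zero , refl
isEmpty≡false⇒member (outside ∷ S) e with isEmpty≡false⇒member S e
... | i , i∈ = suc i , i∈

DoubleHole : ∀ {n} → Subset n → ℕ → ℕ → Set
DoubleHole S m v = member S m ≡ false × member S (suc m) ≡ false × suc m < v × member S v ≡ true

Gap : ∀ {n} → Subset n → Set
Gap S = Σ ℕ λ u → Σ ℕ λ m → Σ ℕ λ v → member S u ≡ true × u < m × DoubleHole S m v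

below-double-hole : ∀ {n} {S : Subset n} {i m} → i ≤ suc m → member S i ≡ true →
                    member S m ≡ false → member S (suc m) ≡ false → i < m
below-double-hole {S = S} {i} {m} i≤1+m i∈ m∉ m+1∉ with m≤n⇒m<n∨m≡n i≤1+m
... | inj₂ refl = contradiction (trans (sym i∈) m+1∉) λ ()
... | inj₁ (s≤s i≤m) with m≤n⇒m<n∨m≡n i≤m
...   | inj₁ i<m = i<m
...   | inj₂ refl = contradiction (trans (sym i∈) m∉) λ ()

-- A step of P²_n moves by at most 2, so it cannot jump over two consecutive non-members.
walk-below-double-hole : ∀ {n} {S : Subset n} {w v m} → Walk P²-Adj S w v → toℕ w < m →
                         member S m ≡ false → member S (suc m) ≡ false → toℕ v < m
walk-below-double-hole (here _) w<m _ _ = w<m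
walk-below-double-hole {S = S} {w = w} {m = m} (step {w = w′} _ (_ , dist≤2) p) w<m m∉ m+1∉ =
  walk-below-double-hole p (below-double-hole {S = S} w′≤1+m (∈⇒member (walk-source p)) m∉ m+1∉) m∉ m+1∉
  where
  w′≤1+m : toℕ w′ ≤ suc m
  w′≤1+m = begin
    toℕ w′                      ≤⟨ m≤n+∣n-m∣ (toℕ w′) (toℕ w) ⟩
    toℕ w + ∣ toℕ w - toℕ w′ ∣  ≤⟨ +-monoʳ-≤ (toℕ w) dist≤2 ⟩
    toℕ w + 2                    ≡⟨ +-comm (toℕ w) 2 ⟩
    suc (suc (toℕ w))            ≤⟨ s≤s w<m ⟩
    suc m                        ∎
    where open ≤-Reasoning

gap⇒disconnected : ∀ {n} {S : Subset n} → Gap S → Disconnected P²-Adj S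
gap⇒disconnected {S = S} (u , m , v , u∈ , u<m , m∉ , m+1∉ , m+1<v , v∈) (_ , walk)
  with member⇒∈ S u u∈ | member⇒∈ S v v∈
... | x , refl , x∈ | y , refl , y∈ =
  <⇒≱ m+1<v (≤-trans (<⇒≤ (walk-below-double-hole (walk x y x∈ y∈) u<m m∉ m+1∉)) (n≤1+n m))

noDoubleGap≡false⇒DoubleHole : ∀ {n} (S : Subset n) → noDoubleGap S ≡ false →
                               Σ ℕ λ m → Σ ℕ λ v → DoubleHole S m v
noDoubleGap≡false⇒DoubleHole (inside ∷ S) e with noDoubleGap≡false⇒DoubleHole S e
... | m , v , m∉ , m+1∉ , m+1<v , v∈ = suc m , suc v , m∉ , m+1∉ , s≤s m+1<v , v∈
noDoubleGap≡false⇒DoubleHole (outside ∷ inside ∷ S) e with noDoubleGap≡false⇒DoubleHole S e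
... | m , v , m∉ , m+1∉ , m+1<v , v∈ = suc (suc m) , suc (suc v) , m∉ , m+1∉ , s≤s (s≤s m+1<v) , v∈
noDoubleGap≡false⇒DoubleHole (outside ∷ outside ∷ S) e with isEmpty≡false⇒member S e
... | i , i∈ = zero , suc (suc i) , refl , refl , s≤s (s≤s z≤n) , i∈

isP²Connected≡false⇒ : ∀ {n} (S : Subset n) → isP²Connected S ≡ false → Empty S ⊎ Gap S
isP²Connected≡false⇒ []            _ = inj₁ λ ()
isP²Connected≡false⇒ (inside ∷ S)  e with noDoubleGap≡false⇒DoubleHole S e
... | m , v , hole = inj₂ (zero , suc m , suc v , refl , s≤s z≤n , hole′)
  where
  hole′ : DoubleHole (inside ∷ S) (suc m) (suc v)
  hole′ = let (m∉ , m+1∉ , m+1<v , v∈) = hole in m∉ , m+1∉ , s≤s m+1<v , v∈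
isP²Connected≡false⇒ (outside ∷ S) e with isP²Connected≡false⇒ S e
... | inj₁ empty = inj₁ λ { (suc x , there x∈) → empty (x , x∈) }
... | inj₂ (u , m , v , u∈ , u<m , m∉ , m+1∉ , m+1<v , v∈) =
  inj₂ (suc u , suc m , suc v , u∈ , s≤s u<m , m∉ , m+1∉ , s≤s m+1<v , v∈)

isP²Connected-complete : ∀ {n} (S : Subset n) → isP²Connected S ≡ false → Disconnected P²-Adj S
isP²Connected-complete S e with isP²Connected≡false⇒ S e
... | inj₁ empty = λ (nonempty , _) → empty nonempty
... | inj₂ gap   = gap⇒disconnected gap

noDoubleGap⇒¬DoubleHole : ∀ {n} (S : Subset n) → noDoubleGap S ≡ true → ∀ m v → ¬ DoubleHole S m v
noDoubleGap⇒¬DoubleHole []                      _ m v (_ , _ , _ , ())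
noDoubleGap⇒¬DoubleHole (inside ∷ S)            _ zero v (() , _)
noDoubleGap⇒¬DoubleHole (inside ∷ S)            e (suc m) (suc v) (m∉ , m+1∉ , s≤s m+1<v , v∈) =
  noDoubleGap⇒¬DoubleHole S e m v (m∉ , m+1∉ , m+1<v , v∈)
noDoubleGap⇒¬DoubleHole (outside ∷ [])          _ m (suc v) (_ , _ , _ , ())
noDoubleGap⇒¬DoubleHole (outside ∷ inside ∷ S)  _ zero v (_ , () , _)
noDoubleGap⇒¬DoubleHole (outside ∷ inside ∷ S)  _ (suc zero) v (() , _)
noDoubleGap⇒¬DoubleHole (outside ∷ inside ∷ S)  e (suc (suc m)) (suc (suc v))
                        (m∉ , m+1∉ , s≤s (s≤s m+1<v) , v∈) =
  noDoubleGap⇒¬DoubleHole S e m v (m∉ , m+1∉ , m+1<v , v∈)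
noDoubleGap⇒¬DoubleHole (outside ∷ outside ∷ S) e m (suc (suc v)) (_ , _ , _ , v∈) =
  contradiction (trans (sym v∈) (isEmpty⇒member≡false S v e)) λ ()

isP²Connected⇒¬Gap : ∀ {n} (S : Subset n) → isP²Connected S ≡ true → ¬ Gap S
isP²Connected⇒¬Gap (outside ∷ S) e (suc u , suc m , suc v , u∈ , s≤s u<m , m∉ , m+1∉ , s≤s m+1<v , v∈) =
  isP²Connected⇒¬Gap S e (u , m , v , u∈ , u<m , m∉ , m+1∉ , m+1<v , v∈)
isP²Connected⇒¬Gap (inside ∷ S) e (_ , suc m , suc v , _ , _ , m∉ , m+1∉ , s≤s m+1<v , v∈) =
  noDoubleGap⇒¬DoubleHole S e m v (m∉ , m+1∉ , m+1<v , v∈)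

+-reassoc : ∀ a b {a′ c} → a′ ≡ a + b → a + (b + c) ≡ a′ + c
+-reassoc a b {c = c} refl = sym (+-assoc a b c)

member-after-hole : ∀ {n} {S : Subset n} → ¬ Gap S → ∀ d {x y} → toℕ y ≡ toℕ x + suc (suc (suc d)) →
                    x ∈ S → y ∈ S → member S (toℕ x + 1) ≡ false → member S (toℕ x + 2) ≡ true
member-after-hole {S = S} ¬gap d {x} {y} y≡x+d+3 x∈ y∈ x+1∉ with member S (toℕ x + 2) in x+2∈?
... | true  = refl
... | false = contradiction gap ¬gap
  where
  x+2<x+d+3 : suc (toℕ x + 1) < toℕ x + suc (suc (suc d))
  x+2<x+d+3 = subst (_< toℕ x + suc (suc (suc d))) (+-suc (toℕ x) 1) (+-monoʳ-< (toℕ x) (s≤s (s≤s (s≤s z≤n))))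
  gap : Gap S
  gap = toℕ x , toℕ x + 1 , toℕ y , ∈⇒member x∈ , m<m+n (toℕ x) (s≤s z≤n) ,
        x+1∉ , subst (λ i → member S i ≡ false) (+-suc (toℕ x) 1) x+2∈? ,
        subst (λ i → suc (toℕ x + 1) < i) (sym y≡x+d+3) x+2<x+d+3 , ∈⇒member y∈

-- The extra argument b records member S (x + 1): splitting on it with a with-abstraction
-- would hide from the termination checker that d decreases.
walk-up : ∀ {n} {S : Subset n} → ¬ Gap S → ∀ d {x y} → toℕ y ≡ toℕ x + d → x ∈ S → y ∈ S →
          ∀ {b} → member S (toℕ x + 1) ≡ b → Walk P²-Adj S x y
walk-up _ zero {x} y≡x+0 _ y∈ _ rewrite toℕ-injective (trans y≡x+0 (+-identityʳ (toℕ x))) = here y∈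
walk-up _ (suc zero) y≡x+1 x∈ y∈ _ = step x∈ (P²-Adj-+ 1 y≡x+1 ≤-refl (s≤s z≤n)) (here y∈)
walk-up {S = S} ¬gap (suc (suc d)) {x} y≡x+d+2 x∈ y∈ {true} x+1∈ =
  let x₁ , x₁≡x+1 , x₁∈ = member⇒∈ S _ x+1∈ in
  step x∈ (P²-Adj-+ 1 x₁≡x+1 ≤-refl (s≤s z≤n))
       (walk-up ¬gap (suc d) (trans y≡x+d+2 (+-reassoc (toℕ x) 1 x₁≡x+1)) x₁∈ y∈ refl)
walk-up ¬gap (suc (suc zero)) y≡x+2 x∈ y∈ {false} _ = step x∈ (P²-Adj-+ 2 y≡x+2 (s≤s z≤n) ≤-refl) (here y∈)
walk-up {S = S} ¬gap (suc (suc (suc d))) {x} y≡x+d+3 x∈ y∈ {false} x+1∉ =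
  let x₂ , x₂≡x+2 , x₂∈ = member⇒∈ S _ (member-after-hole ¬gap d y≡x+d+3 x∈ y∈ x+1∉) in
  step x∈ (P²-Adj-+ 2 x₂≡x+2 (s≤s z≤n) ≤-refl)
       (walk-up ¬gap (suc d) (trans y≡x+d+3 (+-reassoc (toℕ x) 2 x₂≡x+2)) x₂∈ y∈ refl)

isP²Connected⇒nonempty : ∀ {n} (S : Subset n) → isP²Connected S ≡ true → Nonempty S
isP²Connected⇒nonempty (inside ∷ S)  _ = zero , here
isP²Connected⇒nonempty (outside ∷ S) e with isP²Connected⇒nonempty S e
... | x , x∈ = suc x , there x∈

isP²Connected-sound : ∀ {n} (S : Subset n) → isP²Connected S ≡ true → Connected P²-Adj S
isP²Connected-sound S e = isP²Connected⇒nonempty S e , walk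
  where
  ¬gap : ¬ Gap S
  ¬gap = isP²Connected⇒¬Gap S e
  walk : ∀ x y → x ∈ S → y ∈ S → Walk P²-Adj S x y
  walk x y x∈ y∈ with ≤-total (toℕ x) (toℕ y)
  ... | inj₁ x≤y = walk-up ¬gap _ (sym (m+[n∸m]≡n x≤y)) x∈ y∈ refl
  ... | inj₂ y≤x =
    walk-reverse (λ {x} {y} → P²-Adj-sym {x = x} {y}) (walk-up ¬gap _ (sym (m+[n∸m]≡n y≤x)) y∈ x∈ refl)

isP²Connected≡false⇔ : ∀ {n} (S : Subset n) → isP²Connected S ≡ false ⇔ Disconnected P²-Adj S
isP²Connected≡false⇔ S = mk⇔ (isP²Connected-complete S) from
  where
  from : Disconnected P²-Adj S → isP²Connected S ≡ false
  from disc with isP²Connected S in e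
  ... | true  = contradiction (isP²Connected-sound S e) disc
  ... | false = refl

-- Removing elements from a subset

∣x∷p∣≤1+∣p∣ : ∀ {n} x (S : Subset n) → ∣ x ∷ S ∣ ≤ suc ∣ S ∣
∣x∷p∣≤1+∣p∣ inside  S = ≤-refl
∣x∷p∣≤1+∣p∣ outside S = n≤1+n ∣ S ∣

p⊆q∧∣q∣≤∣p∣⇒p≡q : ∀ {n} {T S : Subset n} → T ⊆ S → ∣ S ∣ ≤ ∣ T ∣ → T ≡ S
p⊆q∧∣q∣≤∣p∣⇒p≡q {T = []}          {[]}          _    _ = refl
p⊆q∧∣q∣≤∣p∣⇒p≡q {T = inside ∷ T}  {inside ∷ S}  T⊆S (s≤s ∣S∣≤∣T∣) =
  cong (inside ∷_) (p⊆q∧∣q∣≤∣p∣⇒p≡q (drop-∷-⊆ T⊆S) ∣S∣≤∣T∣)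
p⊆q∧∣q∣≤∣p∣⇒p≡q {T = outside ∷ T} {outside ∷ S} T⊆S ∣S∣≤∣T∣ =
  cong (outside ∷_) (p⊆q∧∣q∣≤∣p∣⇒p≡q (drop-∷-⊆ T⊆S) ∣S∣≤∣T∣)
p⊆q∧∣q∣≤∣p∣⇒p≡q {T = inside ∷ T}  {outside ∷ S} T⊆S _ with T⊆S here
... | ()
p⊆q∧∣q∣≤∣p∣⇒p≡q {T = outside ∷ T} {inside ∷ S}  T⊆S ∣S∣<∣T∣ =
  contradiction (p⊆q⇒∣p∣≤∣q∣ (drop-∷-⊆ T⊆S)) (<⇒≱ ∣S∣<∣T∣)

subsetOfSize : ∀ {n} (S : Subset n) j → j ≤ ∣ S ∣ → Σ (Subset n) λ T → T ⊆ S × ∣ T ∣ ≡ j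
subsetOfSize {n} S zero _ = ⊥ , ⊥⊆ , ∣⊥∣≡0 n
subsetOfSize (inside ∷ S) (suc j) (s≤s j≤∣S∣) =
  let T , T⊆S , ∣T∣≡j = subsetOfSize S j j≤∣S∣ in inside ∷ T , in⊆in T⊆S , cong suc ∣T∣≡j
subsetOfSize (outside ∷ S) (suc j) j<∣S∣ =
  let T , T⊆S , ∣T∣≡j = subsetOfSize S (suc j) j<∣S∣ in outside ∷ T , out⊆ T⊆S , ∣T∣≡j

removeOne : ∀ {n} (S : Subset n) → 1 ≤ ∣ S ∣ → Σ (Subset n) λ T → T ⊆ S × suc ∣ T ∣ ≡ ∣ S ∣
removeOne (inside ∷ S)  _ = outside ∷ S , out⊆ ⊆-refl , refl
removeOne (outside ∷ S) h = let T , T⊆S , ∣T∣+1≡∣S∣ = removeOne S h in outside ∷ T , out⊆ T⊆S , ∣T∣+1≡∣S∣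

isEmpty-⊆ : ∀ {n} {T S : Subset n} → T ⊆ S → isEmpty S ≡ true → isEmpty T ≡ true
isEmpty-⊆ {T = T} {S} T⊆S e =
  ∣∣≡0⇒isEmpty T (n≤0⇒n≡0 (≤-trans (p⊆q⇒∣p∣≤∣q∣ T⊆S) (≤-reflexive (isEmpty⇒∣∣≡0 S e))))

initialSegment-minus-one : ∀ {n} {T S : Subset n} → isInitialSegment S ≡ true → T ⊆ S → ∣ S ∣ ≤ suc ∣ T ∣ →
                           noDoubleGap T ≡ true
initialSegment-minus-one {T = []}          {[]}          _ _ _ = refl
initialSegment-minus-one {T = inside ∷ T}  {inside ∷ S}  e T⊆S (s≤s h) =
  initialSegment-minus-one e (drop-∷-⊆ T⊆S) h
initialSegment-minus-one {T = outside ∷ T} {inside ∷ S}  e T⊆S (s≤s h) with p⊆q∧∣q∣≤∣p∣⇒p≡q (drop-∷-⊆ T⊆S) h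
... | refl = isInitialSegment⇒noDoubleGap-outside T e
initialSegment-minus-one {T = outside ∷ T} {outside ∷ S} e T⊆S _ =
  isInitialSegment⇒noDoubleGap (outside ∷ T) (isEmpty-⊆ (drop-∷-⊆ T⊆S) e)
initialSegment-minus-one {T = inside ∷ T}  {outside ∷ S} _ T⊆S _ with T⊆S here
... | ()

interval-minus-one : ∀ {n} {T S : Subset n} → isInterval S ≡ true → T ⊆ S → ∣ S ∣ ≤ suc ∣ T ∣ → 1 ≤ ∣ T ∣ →
                     isP²Connected T ≡ true
interval-minus-one {T = outside ∷ T} {outside ∷ S} e T⊆S h t = interval-minus-one e (drop-∷-⊆ T⊆S) h t
interval-minus-one {T = inside ∷ T}  {inside ∷ S}  e T⊆S (s≤s h) _ = initialSegment-minus-one e (drop-∷-⊆ T⊆S) h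
interval-minus-one {T = outside ∷ T} {inside ∷ S}  e T⊆S (s≤s h) t with p⊆q∧∣q∣≤∣p∣⇒p≡q (drop-∷-⊆ T⊆S) h
... | refl = isInitialSegment⇒isP²Connected T e t
interval-minus-one {T = inside ∷ T}  {outside ∷ S} _ T⊆S _ _ with T⊆S here
... | ()

nonInitialSegment-minus-one : ∀ {n} (S : Subset n) → isInitialSegment S ≡ false → 2 ≤ ∣ S ∣ →
                              Σ (Subset n) λ T → T ⊆ S × suc ∣ T ∣ ≡ ∣ S ∣ × noDoubleGap T ≡ false
nonInitialSegment-minus-one (inside ∷ outside ∷ S) e _ = outside ∷ outside ∷ S , out⊆ ⊆-refl , refl , e
nonInitialSegment-minus-one (inside ∷ inside ∷ S) e _
  with nonInitialSegment-minus-one (inside ∷ S) e (s≤s (isInitialSegment≡false⇒1≤∣∣ S e))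
... | T , T⊆S , ∣T∣+1≡∣S∣ , gap = inside ∷ T , in⊆in T⊆S , cong suc ∣T∣+1≡∣S∣ , gap
nonInitialSegment-minus-one (outside ∷ inside ∷ S) _ (s≤s h) =
  outside ∷ outside ∷ S , out⊆ (out⊆ ⊆-refl) , refl , ∣∣≢0⇒isEmpty≡false S h
nonInitialSegment-minus-one (outside ∷ outside ∷ S) _ h with removeOne S (≤-trans (n≤1+n 1) h)
... | T , T⊆S , ∣T∣+1≡∣S∣ =
  outside ∷ outside ∷ T , out⊆ (out⊆ T⊆S) , ∣T∣+1≡∣S∣ ,
  ∣∣≢0⇒isEmpty≡false T (≤-pred (subst (2 ≤_) (sym ∣T∣+1≡∣S∣) h))

nonInterval-minus-one : ∀ {n} (S : Subset n) → isInterval S ≡ false → 3 ≤ ∣ S ∣ →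
                        Σ (Subset n) λ T → T ⊆ S × suc ∣ T ∣ ≡ ∣ S ∣ × isP²Connected T ≡ false
nonInterval-minus-one (outside ∷ S) e h with nonInterval-minus-one S e h
... | T , T⊆S , ∣T∣+1≡∣S∣ , disc = outside ∷ T , out⊆ T⊆S , ∣T∣+1≡∣S∣ , disc
nonInterval-minus-one (inside ∷ S) e (s≤s h) with nonInitialSegment-minus-one S e h
... | T , T⊆S , ∣T∣+1≡∣S∣ , gap = inside ∷ T , in⊆in T⊆S , cong suc ∣T∣+1≡∣S∣ , gap

large⇒disconnectedSubset : ∀ {n} (S : Subset n) k → 2 ≤ k → 2 + k ≤ ∣ S ∣ →
                         Σ (Subset n) λ T → T ⊆ S × ∣ T ∣ ≡ k × isP²Connected T ≡ false
large⇒disconnectedSubset (outside ∷ S) k 2≤k h with large⇒disconnectedSubset S k 2≤k h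
... | T , T⊆S , ∣T∣≡k , disc = outside ∷ T , out⊆ T⊆S , ∣T∣≡k , disc
large⇒disconnectedSubset (inside ∷ a ∷ b ∷ S) (suc j) (s≤s 1≤j) h
  with ≤-trans h (s≤s (≤-trans (∣x∷p∣≤1+∣p∣ a (b ∷ S)) (s≤s (∣x∷p∣≤1+∣p∣ b S))))
... | s≤s (s≤s (s≤s j≤∣S∣)) with subsetOfSize S j j≤∣S∣
...   | T , T⊆S , ∣T∣≡j =
  inside ∷ outside ∷ outside ∷ T , in⊆in (out⊆ (out⊆ T⊆S)) , cong suc ∣T∣≡j ,
  ∣∣≢0⇒isEmpty≡false T (subst (1 ≤_) (sym ∣T∣≡j) 1≤j)
large⇒disconnectedSubset (inside ∷ []) (suc j) _ (s≤s ())
large⇒disconnectedSubset (inside ∷ a ∷ []) (suc j) _ h with ≤-trans h (s≤s (∣x∷p∣≤1+∣p∣ a []))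
... | s≤s (s≤s ())

-- Faces of the cut complex through their complements

∁-involutive : ∀ {n} (S : Subset n) → ∁ (∁ S) ≡ S
∁-involutive S = trans (sym (map-∘ not not S)) (trans (map-cong not-involutive S) (map-id S))

∁-injective : ∀ {n} {S S′ : Subset n} → ∁ S ≡ ∁ S′ → S ≡ S′
∁-injective {S = S} {S′} eq = trans (sym (∁-involutive S)) (trans (cong ∁ eq) (∁-involutive S′))

p⊆∁q⇒q⊆∁p : ∀ {n} {F S : Subset n} → F ⊆ ∁ S → S ⊆ ∁ F
p⊆∁q⇒q⊆∁p F⊆∁S x∈S = x∉p⇒x∈∁p λ x∈F → x∈∁p⇒x∉p (F⊆∁S x∈F) x∈S

HasDisconnectedSubset : ∀ {n} → (Fin n → Fin n → Set) → ℕ → Subset n → Set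
HasDisconnectedSubset {n} Adj k S = Σ (Subset n) λ T → T ⊆ S × ∣ T ∣ ≡ k × Disconnected Adj T

isCutFace⇔ : ∀ {n} {Adj : Fin n → Fin n → Set} {k} {F : Subset n} →
             IsCutFace Adj k F ⇔ HasDisconnectedSubset Adj k (∁ F)
isCutFace⇔ = mk⇔ (λ (T , ∣T∣≡k , disc , F⊆∁T) → T , p⊆∁q⇒q⊆∁p F⊆∁T , ∣T∣≡k , disc)
                 (λ (T , T⊆∁F , ∣T∣≡k , disc) → T , ∣T∣≡k , disc , p⊆∁q⇒q⊆∁p T⊆∁F)

cutFace-size : ∀ {n} {Adj : Fin n → Fin n → Set} {k} {F : Subset n} → IsCutFace Adj k F → ∣ F ∣ ≤ n ∸ k
cutFace-size {n} {k = k} {F} (T , ∣T∣≡k , _ , F⊆∁T) = begin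
  ∣ F ∣    ≤⟨ p⊆q⇒∣p∣≤∣q∣ F⊆∁T ⟩
  ∣ ∁ T ∣  ≡⟨ ∣∁p∣≡n∸∣p∣ T ⟩
  n ∸ ∣ T ∣ ≡⟨ cong (n ∸_) ∣T∣≡k ⟩
  n ∸ k ∎
  where open ≤-Reasoning

numFaces-none : ∀ {n} (Adj : Fin n → Fin n → Set) k p → n ∸ k < p → NumFaces Adj k p 0
numFaces-none Adj k p n∸k<p =
  [] , [] , (λ F → mk⇔ (λ ()) (too-large F)) , refl
  where
  too-large : ∀ F → IsCutFace Adj k F × ∣ F ∣ ≡ p → F ∈ₗ []
  too-large F (face , ∣F∣≡p) = contradiction (subst (_≤ _) ∣F∣≡p (cutFace-size face)) (<⇒≱ n∸k<p)

numFaces-count : ∀ {n} (Adj : Fin n → Fin n → Set) k p q → q + p ≡ n → (P : Subset n → Bool) →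
                 (∀ S → ∣ S ∣ ≡ q → T (P S) ⇔ HasDisconnectedSubset Adj k S) →
                 NumFaces Adj k p (count n P q)
numFaces-count {n} Adj k p q q+p≡n P P⇔ =
  map ∁ Ss , Unique.map⁺ ∁-injective (Unique.filter⁺ (T? ∘ P) (subsets-unique n q)) ,
  (λ F → mk⇔ (faces⁻ F) (faces⁺ F)) , length-map ∁ Ss
  where
  Ss = filterᵇ P (subsets n q)
  ∣∁S∣ : ∀ {x y} (S : Subset n) → ∣ S ∣ ≡ x → x + y ≡ n → ∣ ∁ S ∣ ≡ y
  ∣∁S∣ {x} {y} S ∣S∣≡x x+y≡n = begin
    ∣ ∁ S ∣   ≡⟨ ∣∁p∣≡n∸∣p∣ S ⟩
    n ∸ ∣ S ∣ ≡⟨ cong₂ _∸_ (sym x+y≡n) ∣S∣≡x ⟩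
    x + y ∸ x ≡⟨ m+n∸m≡n x y ⟩
    y ∎
    where open ≡-Reasoning
  faces⁻ : ∀ F → F ∈ₗ map ∁ Ss → IsCutFace Adj k F × ∣ F ∣ ≡ p
  faces⁻ F F∈ with ∈-map⁻ ∁ F∈
  ... | S , S∈ , refl with ∈-filter⁻ (T? ∘ P) S∈
  ... | S∈subsets , PS =
    Equivalence.from isCutFace⇔
      (subst (HasDisconnectedSubset Adj k) (sym (∁-involutive S)) (Equivalence.to (P⇔ S ∣S∣≡q) PS)) ,
    ∣∁S∣ S ∣S∣≡q q+p≡n
    where ∣S∣≡q = ∈-subsets⁻ S∈subsets
  faces⁺ : ∀ F → IsCutFace Adj k F × ∣ F ∣ ≡ p → F ∈ₗ map ∁ Ss
  faces⁺ F (face , ∣F∣≡p) = subst (_∈ₗ map ∁ Ss) (∁-involutive F)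
    (∈-map⁺ ∁ (∈-filter⁺ (T? ∘ P) (∈-subsets⁺ (∁ F) ∣∁F∣≡q)
                                  (Equivalence.from (P⇔ (∁ F) ∣∁F∣≡q) (Equivalence.to isCutFace⇔ face))))
    where ∣∁F∣≡q = ∣∁S∣ F ∣F∣≡p (trans (+-comm p q) q+p≡n)

-- The coefficients of F_{k,n}

[≤?]-≤ : ∀ {a b} → a ≤ b → [ a ≤? b ] ≡ 1
[≤?]-≤ z≤n       = refl
[≤?]-≤ (s≤s a≤b) = [≤?]-≤ a≤b

[≤?]-> : ∀ {a b} → b < a → [ a ≤? b ] ≡ 0
[≤?]-> {suc a} {zero}  _         = refl
[≤?]-> {suc a} {suc b} (s≤s b<a) = [≤?]-> b<a

[≡?]-refl : ∀ a → [ a ≡? a ] ≡ 1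
[≡?]-refl a rewrite [≤?]-≤ (≤-refl {a}) = refl

[≡?]-< : ∀ {a b} → a < b → [ a ≡? b ] ≡ 0
[≡?]-< {a} {b} a<b rewrite [≤?]-> a<b = *-zeroʳ [ a ≤? b ]

[≡?]-> : ∀ {a b} → b < a → [ a ≡? b ] ≡ 0
[≡?]-> b<a rewrite [≤?]-> b<a = refl

coeffF-indicators : ∀ k n p {a b c} → [ p ≤? n ∸ k ] ≡ a → [ p ≡? (n ∸ k ∸ 1) ] ≡ b → [ p ≡? n ∸ k ] ≡ c →
                    coeffF k n p ≡ + (a * (n C p)) ℤ.- + (b * (n ∸ k)) ℤ.- + (c * z k n)
coeffF-indicators k n p refl refl refl = refl

coeffF-above : ∀ k n p → n ∸ k < p → coeffF k n p ≡ + 0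
coeffF-above k n p r<p =
  coeffF-indicators k n p ([≤?]-> r<p) ([≡?]-> (≤-<-trans (m∸n≤m (n ∸ k) 1) r<p)) ([≡?]-> r<p)

coeffF-top : ∀ k n p → p ≡ n ∸ k → 1 ≤ p → coeffF k n p ≡ + (n C p) ℤ.- + z k n
coeffF-top k n p refl 1≤p = begin
  coeffF k n p
    ≡⟨ coeffF-indicators k n p ([≤?]-≤ {p} ≤-refl) ([≡?]-> (∸-monoʳ-< ≤-refl 1≤p)) ([≡?]-refl p) ⟩
  + (1 * (n C p)) ℤ.- + 0 ℤ.- + (1 * z k n)
    ≡⟨ cong₂ (λ x y → + x ℤ.- + y) (trans (+-identityʳ (1 * (n C p))) (*-identityˡ (n C p)))
                                   (*-identityˡ (z k n)) ⟩
  + (n C p) ℤ.- + z k n ∎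
  where open ≡-Reasoning

coeffF-next : ∀ k n p → suc p ≡ n ∸ k → coeffF k n p ≡ + (n C p) ℤ.- + suc p
coeffF-next k n p 1+p≡r = begin
  coeffF k n p
    ≡⟨ coeffF-indicators k n p ([≤?]-≤ (subst (p ≤_) 1+p≡r (n≤1+n p)))
                               (subst (λ r → [ p ≡? r ∸ 1 ] ≡ 1) 1+p≡r ([≡?]-refl p))
                               (subst (λ r → [ p ≡? r ] ≡ 0) 1+p≡r ([≡?]-< {p} ≤-refl)) ⟩
  + (1 * (n C p)) ℤ.- + (1 * (n ∸ k)) ℤ.- + 0
    ≡⟨ ℤP.+-identityʳ _ ⟩
  + (1 * (n C p)) ℤ.- + (1 * (n ∸ k))
    ≡⟨ cong₂ (λ x y → + x ℤ.- + y) (*-identityˡ (n C p)) (trans (*-identityˡ (n ∸ k)) (sym 1+p≡r)) ⟩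
  + (n C p) ℤ.- + suc p ∎
  where open ≡-Reasoning

coeffF-low : ∀ k n p → 2 + p ≤ n ∸ k → coeffF k n p ≡ + (n C p)
coeffF-low k n p 2+p≤r = begin
  coeffF k n p
    ≡⟨ coeffF-indicators k n p ([≤?]-≤ (m+n≤o⇒n≤o 2 2+p≤r)) ([≡?]-< (∸-monoˡ-≤ 1 2+p≤r))
                               ([≡?]-< (m+n≤o⇒n≤o 1 2+p≤r)) ⟩
  + (1 * (n C p)) ℤ.- + 0 ℤ.- + 0
    ≡⟨ trans (ℤP.+-identityʳ _) (ℤP.+-identityʳ _) ⟩
  + (1 * (n C p))
    ≡⟨ cong +_ (*-identityˡ (n C p)) ⟩
  + (n C p) ∎
  where open ≡-Reasoning

m+n≡o⇒+m≡+o-+n : ∀ {m n o} → m + n ≡ o → + m ≡ + o ℤ.- + n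
m+n≡o⇒+m≡+o-+n {m} {n} refl = begin
  + m                ≡⟨ cong +_ (m+n∸n≡m m n) ⟨
  + (m + n ∸ n)      ≡⟨ ℤP.⊖-≥ (m≤n+m n m) ⟨
  (m + n) ℤ.⊖ n      ≡⟨ ℤP.[+m]-[+n]≡m⊖n (m + n) n ⟨
  + (m + n) ℤ.- + n  ∎
  where open ≡-Reasoning

C-complement : ∀ a b {n} → a + b ≡ n → n C a ≡ n C b
C-complement a b refl = trans (nCk≡nC[n∸k] (m≤m+n a b)) (cong ((a + b) C_) (m+n∸m≡n a b))

-- Counting the faces

FaceNumber : ℕ → ℕ → ℕ → Set
FaceNumber k n p = Σ ℕ λ m → NumFaces {n} P²-Adj k p m × (+ m ≡ coeffF k n p)

faceNumber-above : ∀ k n p → n ∸ k < p → FaceNumber k n p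
faceNumber-above k n p r<p = 0 , numFaces-none P²-Adj k p r<p , sym (coeffF-above k n p r<p)

faceNumber-top : ∀ k r → 1 ≤ k → 1 ≤ r → FaceNumber k (k + r) r
faceNumber-top (suc s) r _ 1≤r =
  count n (not ∘ isP²Connected) k ,
  numFaces-count P²-Adj k r k refl (not ∘ isP²Connected) disconnected⇔ ,
  trans (m+n≡o⇒+m≡+o-+n total) (sym (coeffF-top k n r (sym (m+n∸m≡n k r)) 1≤r))
  where
  k = suc s
  n = k + r
  total : count n (not ∘ isP²Connected) k + z k n ≡ n C r
  total = begin
    count n (not ∘ isP²Connected) k + z k n
      ≡⟨ cong (λ x → count n (not ∘ isP²Connected) k + x) (count-isP²Connected≡z s r) ⟨
    count n (not ∘ isP²Connected) k + count n isP²Connected k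
      ≡⟨ count-not n isP²Connected k ⟩
    n C k
      ≡⟨ C-complement k r refl ⟩
    n C r ∎
    where open ≡-Reasoning
  disconnected⇔ : (S : Subset n) → ∣ S ∣ ≡ k → T (not (isP²Connected S)) ⇔ HasDisconnectedSubset P²-Adj k S
  disconnected⇔ S ∣S∣≡k = mk⇔ to from
    where
    to : T (not (isP²Connected S)) → HasDisconnectedSubset P²-Adj k S
    to t = S , ⊆-refl , ∣S∣≡k , Equivalence.to (isP²Connected≡false⇔ S) (Equivalence.to T-not-≡ t)
    from : HasDisconnectedSubset P²-Adj k S → T (not (isP²Connected S))
    from (U , U⊆S , ∣U∣≡k , disc) with p⊆q∧∣q∣≤∣p∣⇒p≡q U⊆S (≤-reflexive (trans ∣S∣≡k (sym ∣U∣≡k)))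
    ... | refl = Equivalence.from T-not-≡ (Equivalence.from (isP²Connected≡false⇔ U) disc)

faceNumber-next : ∀ k p → 2 ≤ k → FaceNumber k (k + suc p) p
faceNumber-next k p 2≤k =
  count n (not ∘ isInterval) (suc k) ,
  numFaces-count P²-Adj k p (suc k) (sym (+-suc k p)) (not ∘ isInterval) nonInterval⇔ ,
  trans (m+n≡o⇒+m≡+o-+n total) (sym (coeffF-next k n p (sym (m+n∸m≡n k (suc p)))))
  where
  n = k + suc p
  intervals : count n isInterval (suc k) ≡ suc p
  intervals = trans (cong (λ m → count m isInterval (suc k)) (+-suc k p)) (count-isInterval k p)
  total : count n (not ∘ isInterval) (suc k) + suc p ≡ n C p
  total = begin
    count n (not ∘ isInterval) (suc k) + suc p
      ≡⟨ cong (λ x → count n (not ∘ isInterval) (suc k) + x) intervals ⟨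
    count n (not ∘ isInterval) (suc k) + count n isInterval (suc k)
      ≡⟨ count-not n isInterval (suc k) ⟩
    n C suc k
      ≡⟨ C-complement (suc k) p (sym (+-suc k p)) ⟩
    n C p ∎
    where open ≡-Reasoning
  nonInterval⇔ : (S : Subset n) → ∣ S ∣ ≡ suc k → T (not (isInterval S)) ⇔ HasDisconnectedSubset P²-Adj k S
  nonInterval⇔ S ∣S∣≡1+k = mk⇔ to from
    where
    to : T (not (isInterval S)) → HasDisconnectedSubset P²-Adj k S
    to t with nonInterval-minus-one S (Equivalence.to T-not-≡ t) (subst (3 ≤_) (sym ∣S∣≡1+k) (s≤s 2≤k))
    ... | U , U⊆S , ∣U∣+1≡∣S∣ , disc =
      U , U⊆S , suc-injective (trans ∣U∣+1≡∣S∣ ∣S∣≡1+k) , isP²Connected-complete U disc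
    from : HasDisconnectedSubset P²-Adj k S → T (not (isInterval S))
    from (U , U⊆S , ∣U∣≡k , disc) with isInterval S in e
    ... | false = _
    ... | true  = disc (isP²Connected-sound U (interval-minus-one e U⊆S
                   (≤-reflexive (trans ∣S∣≡1+k (cong suc (sym ∣U∣≡k))))
                   (subst (1 ≤_) (sym ∣U∣≡k) (≤-trans (s≤s z≤n) 2≤k))))

faceNumber-low : ∀ k r p → 2 ≤ k → 2 + p ≤ r → FaceNumber k (k + r) p
faceNumber-low k r p 2≤k 2+p≤r =
  count n (λ _ → true) q ,
  numFaces-count P²-Adj k p q q+p≡n (λ _ → true) large⇔ ,
  trans (cong +_ (trans (count-all n _ q λ _ _ → refl) (C-complement q p q+p≡n)))
        (sym (coeffF-low k n p (subst (2 + p ≤_) (sym (m+n∸m≡n k r)) 2+p≤r)))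
  where
  n = k + r
  q = k + (r ∸ p)
  q+p≡n : q + p ≡ n
  q+p≡n = trans (+-assoc k (r ∸ p) p) (cong (λ x → k + x) (m∸n+n≡m (m+n≤o⇒n≤o 2 2+p≤r)))
  2+k≤q : 2 + k ≤ q
  2+k≤q = subst (_≤ q) (+-comm k 2) (+-monoʳ-≤ k (m+n≤o⇒m≤o∸n 2 2+p≤r))
  large⇔ : (S : Subset n) → ∣ S ∣ ≡ q → ⊤ ⇔ HasDisconnectedSubset P²-Adj k S
  large⇔ S ∣S∣≡q = mk⇔ to _
    where
    to : ⊤ → HasDisconnectedSubset P²-Adj k S
    to _ with large⇒disconnectedSubset S k 2≤k (subst (2 + k ≤_) (sym ∣S∣≡q) 2+k≤q)
    ... | U , U⊆S , ∣U∣≡k , disc = U , U⊆S , ∣U∣≡k , isP²Connected-complete U disc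

faceNumber : ∀ k r → 2 ≤ k → 1 ≤ r → ∀ p → FaceNumber k (k + r) p
faceNumber k r 2≤k 1≤r p with <-cmp p r
... | tri> _ _ r<p  = faceNumber-above k (k + r) p (subst (_< p) (sym (m+n∸m≡n k r)) r<p)
... | tri≈ _ refl _ = faceNumber-top k p (≤-trans (s≤s z≤n) 2≤k) 1≤r
... | tri< p<r _ _ with m≤n⇒m<n∨m≡n p<r
...   | inj₂ refl  = faceNumber-next k p 2≤k
...   | inj₁ 1+p<r = faceNumber-low k r p 2≤k 1+p<r

theorem4p1 : (n k : ℕ) → 2 ≤ k → k ≤ n ∸ 2 →
    (p : ℕ) → Σ ℕ λ m → NumFaces {n} P²-Adj k p m × (+ m ≡ coeffF k n p)
theorem4p1 n k 2≤k k≤n∸2 p =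
  subst (λ n → FaceNumber k n p) (m+[n∸m]≡n (<⇒≤ k<n)) (faceNumber k (n ∸ k) 2≤k (m<n⇒0<n∸m k<n) p)
  where
  k<n : k < n
  k<n = ≤-<-trans k≤n∸2 (∸-monoʳ-< (s≤s z≤n) (≤-trans 2≤k (≤-trans k≤n∸2 (m∸n≤m n 2))))
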